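{- For every $\lambda\in\omega\cup\{\infty\}$ there is a complete first-order theory $T_\lambda$ with $\mathrm{acl}\text{ - }\mathrm{dcl}_{\mathrm{dif}}(T_\lambda)=\lambda$.
   Context: Work in a big saturated model $\mathcal{M}$ of a theory $T$; sets of $T$ are subsets of $M$. For $A\subseteq M$, $\mathrm{acl}(A)$ is the union of the solution sets of all formulas $\varphi(x,\bar a)$, $\bar a$ from $A$, with finitely many solutions, and $\mathrm{dcl}(A)$ is the union of the solution sets of all such formulas with exactly one solution. The $\mathrm{acl}$-$\mathrm{dcl}$-difference $\mathrm{acl}\text{ - }\mathrm{dcl}_{\mathrm{dif}}(T)$ is the least $n\in\omega$ such that $\mathrm{dcl}(A)=\mathrm{acl}(A)$ for every set $A$ with $|A|\geq n$; if no such $n$ exists (i.e. for every $n$ there is $A$ with $|A|\geq n$ and $\mathrm{acl}(A)\supsetneq\mathrm{dcl}(A)$), it is $\infty$. -}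

module Defs where

open import Data.Nat using (ℕ; zero; suc; _<_)
open import Data.Fin using (Fin)
open import Data.Vec using (Vec; []; _∷_; lookup)
open import Data.Vec.Relation.Unary.All using (All)
open import Data.List using (List)
open import Data.List.Membership.Propositional using (_∈_)
open import Data.Product using (Σ; ∃; _×_; _,_)
open import Data.Sum using (_⊎_)
open import Data.Empty using (⊥)
open import Data.Unit using (⊤)
open import Relation.Nullary using (¬_)
open import Relation.Binary.PropositionalEquality using (_≡_)
open import Function.Definitions using (Injective)

record Language : Set₁ where
  field
    Func : ℕ → Set
    Rel  : ℕ → Set
open Language public

module _ (L : Language) where

  data Term (n : ℕ) : Set where
    var  : Fin n → Term n
    func : ∀ {k} → Func L k → Vec (Term n) k → Term n

  data Formula : ℕ → Set where
    ⊥'   : ∀ {n} → Formula n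
    _≐_  : ∀ {n} → Term n → Term n → Formula n
    rel  : ∀ {n k} → Rel L k → Vec (Term n) k → Formula n
    _⇒_  : ∀ {n} → Formula n → Formula n → Formula n
    _∧'_ : ∀ {n} → Formula n → Formula n → Formula n
    _∨'_ : ∀ {n} → Formula n → Formula n → Formula n
    ∀'   : ∀ {n} → Formula (suc n) → Formula n
    ∃'   : ∀ {n} → Formula (suc n) → Formula n

  Sentence : Set
  Sentence = Formula 0

  ¬' : ∀ {n} → Formula n → Formula n
  ¬' φ = φ ⇒ ⊥'

  Theory : Set₁
  Theory = Sentence → Set

  record Structure : Set₁ where
    field
      Carrier : Set
      funcᴹ   : ∀ {k} → Func L k → Vec Carrier k → Carrier
      relᴹ    : ∀ {k} → Rel L k → Vec Carrier k → Set
  open Structure public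

  module _ (M : Structure) where
    private C = Carrier M

    evalT : ∀ {n} → Term n → Vec C n → C
    evalTs : ∀ {n k} → Vec (Term n) k → Vec C n → Vec C k
    evalT (var i) ρ = lookup ρ i
    evalT (func f ts) ρ = funcᴹ M f (evalTs ts ρ)
    evalTs [] ρ = []
    evalTs (t ∷ ts) ρ = evalT t ρ ∷ evalTs ts ρ

    Sat : ∀ {n} → Formula n → Vec C n → Set
    Sat ⊥' ρ = ⊥
    Sat (s ≐ t) ρ = evalT s ρ ≡ evalT t ρ
    Sat (rel R ts) ρ = relᴹ M R (evalTs ts ρ)
    Sat (φ ⇒ ψ) ρ = Sat φ ρ → Sat ψ ρ
    Sat (φ ∧' ψ) ρ = Sat φ ρ × Sat ψ ρ
    Sat (φ ∨' ψ) ρ = Sat φ ρ ⊎ Sat ψ ρ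
    Sat (∀' φ) ρ = (c : C) → Sat φ (c ∷ ρ)
    Sat (∃' φ) ρ = Σ C λ c → Sat φ (c ∷ ρ)

    _⊨_ : Sentence → Set
    _⊨_ φ = Sat φ []

    IsModel : Theory → Set
    IsModel T = ∀ φ → T φ → _⊨_ φ

    -- A formula φ(x, ȳ) with parameters ā from A is φ : Formula (suc k)
    -- together with ā : Vec C k, all of whose entries lie in A;
    -- x is the variable 0.

    Solutions : ∀ {k} → Formula (suc k) → Vec C k → C → Set
    Solutions φ ā b = Sat φ (b ∷ ā)

    FinitelyManySolutions : ∀ {k} → Formula (suc k) → Vec C k → Set
    FinitelyManySolutions φ ā =
      Σ (List C) λ xs → ∀ b → Solutions φ ā b → b ∈ xs

    UniqueSolution : ∀ {k} → Formula (suc k) → Vec C k → Set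
    UniqueSolution φ ā =
      Σ C λ c → Solutions φ ā c × (∀ b → Solutions φ ā b → b ≡ c)

    acl : (C → Set) → C → Set
    acl A b = Σ ℕ λ k → Σ (Formula (suc k)) λ φ → Σ (Vec C k) λ ā →
      All A ā × FinitelyManySolutions φ ā × Solutions φ ā b

    dcl : (C → Set) → C → Set
    dcl A b = Σ ℕ λ k → Σ (Formula (suc k)) λ φ → Σ (Vec C k) λ ā →
      All A ā × UniqueSolution φ ā × Solutions φ ā b

    CardGeq : (C → Set) → ℕ → Set
    CardGeq A n = Σ (Fin n → C) λ f → Injective _≡_ _≡_ f × (∀ i → A (f i))

  _⊨ᵀ_ : Theory → Sentence → Set₁
  T ⊨ᵀ φ = (M : Structure) → IsModel M T → M ⊨ φ

  Complete : Theory → Set₁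
  Complete T = Σ Structure (λ M → IsModel M T) ×
               (∀ (φ : Sentence) → (T ⊨ᵀ φ) ⊎ (T ⊨ᵀ ¬' φ))

  AclDclAbove : Theory → ℕ → Set₁
  AclDclAbove T n = (M : Structure) → IsModel M T → (A : Carrier M → Set) →
    CardGeq M A n →
    ∀ b → (acl M A b → dcl M A b) × (dcl M A b → acl M A b)

data ℕ∞ : Set where
  fin : ℕ → ℕ∞
  ∞   : ℕ∞

AclDclDif : (L : Language) → Theory L → ℕ∞ → Set₁
AclDclDif L T (fin n) = AclDclAbove L T n × (∀ m → m < n → ¬ AclDclAbove L T m)
AclDclDif L T ∞       = ∀ n → ¬ AclDclAbove L T n

-- Both theories are theories of explicit structures M, complete because satisfaction in M
-- is decidable: over any finite tuple of parameters, M has finitely many orbits under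
-- automorphisms fixing the tuple, so quantifiers can be checked on orbit representatives.
-- For λ = n take a pure set with n + 1 elements: if a₁, …, aₙ are distinct elements of A,
-- any element other than the aᵢ is the unique element avoiding them, while a smaller A
-- leaves two elements outside it that a transposition swaps. For λ = ∞ take an equivalence
-- relation with infinitely many classes of size 3: a transversal A can be arbitrarily large,
-- yet the other two members of the class of some a ∈ A are algebraic over A and swapped by
-- an automorphism fixing A.
module Submission where

open import Defs
open import Algebra.Definitions using (Involutive)
open import Data.Empty using (⊥; ⊥-elim)
open import Data.Fin as Fin using (Fin; zero; suc; toℕ; inject≤)
open import Data.Fin.Patterns using (0F; 1F; 2F)
import Data.Fin.Properties as Fin
open import Data.List as List using (List; allFin; upTo; cartesianProduct)
open import Data.List.Membership.Propositional using (_∈_; lose)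
open import Data.List.Membership.Propositional.Properties
  using (∈-allFin; ∈-upTo⁺; ∈-cartesianProduct⁺; ∈-map⁺)
open import Data.List.Relation.Unary.All as ListAll using ()
open import Data.List.Relation.Unary.Any as Any using (any?)
open import Data.Nat as ℕ using (ℕ; zero; suc; _+_; _<_; s≤s)
import Data.Nat.Properties as ℕ
open import Data.Product using (Σ; ∃; _×_; _,_; proj₁; proj₂)
open import Data.Product.Properties using (≡-dec)
open import Data.Sum using (_⊎_; inj₁; inj₂)
open import Data.Vec using (Vec; []; _∷_; lookup; map; tabulate)
open import Data.Vec.Properties using (lookup-map; map-∘; map-id; map-cong; lookup∘tabulate)
open import Data.Vec.Relation.Unary.All as VecAll using ([]; _∷_)
open import Data.Vec.Relation.Unary.All.Properties using (tabulate⁺; lookup⁺)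
open import Function.Bundles using (_⇔_; mk⇔; Equivalence)
open import Function.Definitions using (Injective)
open import Relation.Binary.Definitions using (DecidableEquality)
open import Relation.Binary.PropositionalEquality
  using (_≡_; _≢_; refl; sym; trans; cong; cong₂; subst)
open import Relation.Nullary using (¬_; Dec; yes; no)
import Relation.Nullary.Decidable as Dec
open import Relation.Nullary.Decidable.Core using (_→-dec_; _×-dec_; _⊎-dec_; toSum; fromSum)

open Equivalence using (to; from)

map-fixed : ∀ {C : Set} {P : C → Set} (f : C → C) → (∀ x → P x → f x ≡ x) →
            ∀ {n} {xs : Vec C n} → VecAll.All P xs → map f xs ≡ xs
map-fixed f fixed []       = refl
map-fixed f fixed (p ∷ ps) = cong₂ _∷_ (fixed _ p) (map-fixed f fixed ps)

module Transposition {A : Set} (_≟_ : DecidableEquality A) where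

  transpose : A → A → A → A
  transpose a b x with x ≟ a | x ≟ b
  ... | yes _ | _     = b
  ... | no _  | yes _ = a
  ... | no _  | no _  = x

  transpose-left : ∀ a b → transpose a b a ≡ b
  transpose-left a b with a ≟ a
  ... | yes _ = refl
  ... | no a≢a = ⊥-elim (a≢a refl)

  transpose-right : ∀ a b → transpose a b b ≡ a
  transpose-right a b with b ≟ a | b ≟ b
  ... | yes b≡a | _     = b≡a
  ... | no _    | yes _ = refl
  ... | no _    | no b≢b = ⊥-elim (b≢b refl)

  transpose-fixed : ∀ {a b x} → x ≢ a → x ≢ b → transpose a b x ≡ x
  transpose-fixed {a} {b} {x} x≢a x≢b with x ≟ a | x ≟ b
  ... | yes x≡a | _     = ⊥-elim (x≢a x≡a)
  ... | no _    | yes x≡b = ⊥-elim (x≢b x≡b)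
  ... | no _    | no _  = refl

  transpose-involutive : ∀ a b → Involutive _≡_ (transpose a b)
  transpose-involutive a b x with x ≟ a | x ≟ b
  ... | yes refl | _       = transpose-right x b
  ... | no _     | yes refl = transpose-left a x
  ... | no x≢a   | no x≢b  = transpose-fixed x≢a x≢b

module _ {L : Language} where

  ⋀ : ∀ {m n} → (Fin m → Formula L n) → Formula L n
  ⋀ {zero}  φs = ¬' L ⊥'
  ⋀ {suc m} φs = φs zero ∧' ⋀ (λ i → φs (suc i))

  ∀ⁿ : ∀ {m} → Formula L m → Sentence L
  ∀ⁿ {zero}  φ = φ
  ∀ⁿ {suc m} φ = ∀ⁿ (∀' φ)

  distinctIfDifferent : ∀ {m} → Fin m → Fin m → Formula L m
  distinctIfDifferent i j with i Fin.≟ j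
  ... | yes _ = ¬' L ⊥'
  ... | no _  = ¬' L (var i ≐ var j)

  pairwiseDistinct : ∀ {m} → Formula L m
  pairwiseDistinct = ⋀ λ i → ⋀ λ j → distinctIfDifferent i j

  equalityDecidable : Sentence L
  equalityDecidable = ∀' (∀' ((x ≐ y) ∨' ¬' L (x ≐ y)))
    where
    x y : Term L 2
    x = var zero
    y = var (suc zero)

PairwiseDistinct : ∀ {C : Set} {m} → Vec C m → Set
PairwiseDistinct xs = ∀ i j → i ≢ j → lookup xs i ≢ lookup xs j

tabulate-pairwiseDistinct : ∀ {C : Set} {m} {f : Fin m → C} →
  Injective _≡_ _≡_ f → PairwiseDistinct (tabulate f)
tabulate-pairwiseDistinct {f = f} f-inj i j i≢j eq = i≢j (f-inj fᵢ≡fⱼ)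
  where
  fᵢ≡fⱼ : f i ≡ f j
  fᵢ≡fⱼ = trans (sym (lookup∘tabulate f i)) (trans eq (lookup∘tabulate f j))

∷-pairwiseDistinct : ∀ {C : Set} {m} {x : C} {xs : Vec C m} →
  (∀ i → x ≢ lookup xs i) → PairwiseDistinct xs → PairwiseDistinct (x ∷ xs)
∷-pairwiseDistinct x∉ distinct zero    zero    0≢0 = ⊥-elim (0≢0 refl)
∷-pairwiseDistinct x∉ distinct zero    (suc j) _   = x∉ j
∷-pairwiseDistinct x∉ distinct (suc i) zero    _   = λ eq → x∉ i (sym eq)
∷-pairwiseDistinct x∉ distinct (suc i) (suc j) i≢j = distinct i j (λ i≡j → i≢j (cong suc i≡j))

module _ {L : Language} (M : Structure L) where

  private
    C = Carrier M

  Sat-⋀ : ∀ {m n} (φs : Fin m → Formula L n) ρ →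
          Sat L M (⋀ φs) ρ ⇔ (∀ i → Sat L M (φs i) ρ)
  Sat-⋀ {zero}  φs ρ = mk⇔ (λ _ ()) (λ _ ())
  Sat-⋀ {suc m} φs ρ = mk⇔
    (λ { (s , ss) zero → s ; (s , ss) (suc i) → to (Sat-⋀ (λ i → φs (suc i)) ρ) ss i })
    (λ ss → ss zero , from (Sat-⋀ (λ i → φs (suc i)) ρ) (λ i → ss (suc i)))

  Sat-∀ⁿ : ∀ {m} (φ : Formula L m) → Sat L M (∀ⁿ φ) [] ⇔ (∀ ρ → Sat L M φ ρ)
  Sat-∀ⁿ {zero}  φ = mk⇔ (λ { s [] → s }) (λ s → s [])
  Sat-∀ⁿ {suc m} φ = mk⇔
    (λ { s (c ∷ ρ) → to (Sat-∀ⁿ (∀' φ)) s ρ c })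
    (λ s → from (Sat-∀ⁿ (∀' φ)) (λ ρ c → s (c ∷ ρ)))

  Sat-distinctIfDifferent : ∀ {m} (i j : Fin m) ρ →
    Sat L M (distinctIfDifferent i j) ρ ⇔ (i ≢ j → lookup ρ i ≢ lookup ρ j)
  Sat-distinctIfDifferent i j ρ with i Fin.≟ j
  ... | yes i≡j = mk⇔ (λ _ i≢j → ⊥-elim (i≢j i≡j)) (λ _ ())
  ... | no i≢j  = mk⇔ (λ s _ → s) (λ d → d i≢j)

  Sat-pairwiseDistinct : ∀ {m} (ρ : Vec C m) →
                         Sat L M pairwiseDistinct ρ ⇔ PairwiseDistinct ρ
  Sat-pairwiseDistinct ρ = mk⇔
    (λ s i j → to (Sat-distinctIfDifferent i j ρ) (to (Sat-⋀ _ ρ) (to (Sat-⋀ _ ρ) s i) j))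
    (λ d → from (Sat-⋀ _ ρ) λ i → from (Sat-⋀ _ ρ) λ j →
             from (Sat-distinctIfDifferent i j ρ) (d i j))

  Sat-equalityDecidable : Sat L M equalityDecidable [] ⇔ DecidableEquality C
  Sat-equalityDecidable = mk⇔ (λ s x y → fromSum (s y x)) (λ _≟_ y x → toSum (x ≟ y))

record Automorphism {L : Language} (M : Structure L) : Set where
  field
    apply unapply : Carrier M → Carrier M
    apply-unapply : ∀ x → apply (unapply x) ≡ x
    unapply-apply : ∀ x → unapply (apply x) ≡ x
    apply-func : ∀ {k} (f : Func L k) xs → apply (funcᴹ M f xs) ≡ funcᴹ M f (map apply xs)
    apply-rel : ∀ {k} (R : Rel L k) xs → relᴹ M R xs ⇔ relᴹ M R (map apply xs)

module _ {L : Language} {M : Structure L} where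

  private
    C = Carrier M

  involutiveAutomorphism : (σ : C → C) → Involutive _≡_ σ →
    (∀ {k} (f : Func L k) xs → σ (funcᴹ M f xs) ≡ funcᴹ M f (map σ xs)) →
    (∀ {k} (R : Rel L k) xs → relᴹ M R xs → relᴹ M R (map σ xs)) →
    Automorphism M
  involutiveAutomorphism σ σσ≡id σ-func σ-rel = record
    { apply = σ ; unapply = σ ; apply-unapply = σσ≡id ; unapply-apply = σσ≡id
    ; apply-func = σ-func
    ; apply-rel = λ R xs → mk⇔ (σ-rel R xs) (λ r → subst (relᴹ M R) (σσ-map xs) (σ-rel R _ r))
    }
    where
    σσ-map : ∀ {k} (xs : Vec C k) → map σ (map σ xs) ≡ xs
    σσ-map xs = trans (sym (map-∘ σ σ xs)) (trans (map-cong σσ≡id xs) (map-id xs))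

  identityAutomorphism : Automorphism M
  identityAutomorphism = record
    { apply = λ x → x ; unapply = λ x → x
    ; apply-unapply = λ _ → refl ; unapply-apply = λ _ → refl
    ; apply-func = λ f xs → cong (funcᴹ M f) (sym (map-id xs))
    ; apply-rel = λ R xs →
        mk⇔ (subst (relᴹ M R) (sym (map-id xs))) (subst (relᴹ M R) (map-id xs))
    }

  module _ (σ : Automorphism M) where
    open Automorphism σ

    apply-injective : Injective _≡_ _≡_ apply
    apply-injective {x} {y} eq =
      trans (sym (unapply-apply x)) (trans (cong unapply eq) (unapply-apply y))

    evalT-apply : ∀ {n} (t : Term L n) ρ → evalT L M t (map apply ρ) ≡ apply (evalT L M t ρ)
    evalTs-apply : ∀ {n k} (ts : Vec (Term L n) k) ρ →
                   evalTs L M ts (map apply ρ) ≡ map apply (evalTs L M ts ρ)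
    evalT-apply (var i) ρ = lookup-map i apply ρ
    evalT-apply (func f ts) ρ =
      trans (cong (funcᴹ M f) (evalTs-apply ts ρ)) (sym (apply-func f (evalTs L M ts ρ)))
    evalTs-apply [] ρ = refl
    evalTs-apply (t ∷ ts) ρ = cong₂ _∷_ (evalT-apply t ρ) (evalTs-apply ts ρ)

    Sat-apply⁺ : ∀ {n} (φ : Formula L n) ρ → Sat L M φ ρ → Sat L M φ (map apply ρ)
    Sat-apply⁻ : ∀ {n} (φ : Formula L n) ρ → Sat L M φ (map apply ρ) → Sat L M φ ρ
    Sat-apply⁺ ⊥' ρ ()
    Sat-apply⁺ (s ≐ t) ρ s≡t =
      trans (evalT-apply s ρ) (trans (cong apply s≡t) (sym (evalT-apply t ρ)))
    Sat-apply⁺ (rel R ts) ρ r =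
      subst (relᴹ M R) (sym (evalTs-apply ts ρ)) (to (apply-rel R _) r)
    Sat-apply⁺ (φ ⇒ ψ) ρ φ→ψ s = Sat-apply⁺ ψ ρ (φ→ψ (Sat-apply⁻ φ ρ s))
    Sat-apply⁺ (φ ∧' ψ) ρ (s , t) = Sat-apply⁺ φ ρ s , Sat-apply⁺ ψ ρ t
    Sat-apply⁺ (φ ∨' ψ) ρ (inj₁ s) = inj₁ (Sat-apply⁺ φ ρ s)
    Sat-apply⁺ (φ ∨' ψ) ρ (inj₂ s) = inj₂ (Sat-apply⁺ ψ ρ s)
    Sat-apply⁺ (∀' φ) ρ s c =
      subst (λ x → Sat L M φ (x ∷ map apply ρ)) (apply-unapply c)
        (Sat-apply⁺ φ (unapply c ∷ ρ) (s (unapply c)))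
    Sat-apply⁺ (∃' φ) ρ (c , s) = apply c , Sat-apply⁺ φ (c ∷ ρ) s
    Sat-apply⁻ ⊥' ρ ()
    Sat-apply⁻ (s ≐ t) ρ s≡t =
      apply-injective (trans (sym (evalT-apply s ρ)) (trans s≡t (evalT-apply t ρ)))
    Sat-apply⁻ (rel R ts) ρ r =
      from (apply-rel R _) (subst (relᴹ M R) (evalTs-apply ts ρ) r)
    Sat-apply⁻ (φ ⇒ ψ) ρ φ→ψ s = Sat-apply⁻ ψ ρ (φ→ψ (Sat-apply⁺ φ ρ s))
    Sat-apply⁻ (φ ∧' ψ) ρ (s , t) = Sat-apply⁻ φ ρ s , Sat-apply⁻ ψ ρ t
    Sat-apply⁻ (φ ∨' ψ) ρ (inj₁ s) = inj₁ (Sat-apply⁻ φ ρ s)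
    Sat-apply⁻ (φ ∨' ψ) ρ (inj₂ s) = inj₂ (Sat-apply⁻ ψ ρ s)
    Sat-apply⁻ (∀' φ) ρ s c = Sat-apply⁻ φ (c ∷ ρ) (s (apply c))
    Sat-apply⁻ (∃' φ) ρ (c , s) =
      unapply c , Sat-apply⁻ φ (unapply c ∷ ρ)
        (subst (λ x → Sat L M φ (x ∷ map apply ρ)) (sym (apply-unapply c)) s)

    Sat-apply-fixing : ∀ {n} (φ : Formula L (suc n)) {ρ} x → map apply ρ ≡ ρ →
                       Sat L M φ (x ∷ ρ) ⇔ Sat L M φ (apply x ∷ ρ)
    Sat-apply-fixing φ {ρ} x fixes = mk⇔
      (λ s → subst (λ ρ′ → Sat L M φ (apply x ∷ ρ′)) fixes (Sat-apply⁺ φ (x ∷ ρ) s))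
      (λ s → Sat-apply⁻ φ (x ∷ ρ) (subst (λ ρ′ → Sat L M φ (apply x ∷ ρ′)) (sym fixes) s))

-- Decidability of satisfaction and completeness of Th M

module _ {L : Language} (M : Structure L) where

  private
    C = Carrier M

  OrbitRepresentatives : ∀ {n} → Vec C n → List C → Set
  OrbitRepresentatives ρ xs = ∀ x → Σ (Automorphism M) λ σ →
    let open Automorphism σ in map apply ρ ≡ ρ × apply x ∈ xs

  module _ (_≟_ : DecidableEquality C)
           (rel? : ∀ {k} (R : Rel L k) xs → Dec (relᴹ M R xs))
           (orbits : ∀ {n} (ρ : Vec C n) → Σ (List C) (OrbitRepresentatives ρ)) where

    Sat? : ∀ {n} (φ : Formula L n) ρ → Dec (Sat L M φ ρ)
    Sat? ⊥' ρ = no λ ()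
    Sat? (s ≐ t) ρ = evalT L M s ρ ≟ evalT L M t ρ
    Sat? (rel R ts) ρ = rel? R (evalTs L M ts ρ)
    Sat? (φ ⇒ ψ) ρ = Sat? φ ρ →-dec Sat? ψ ρ
    Sat? (φ ∧' ψ) ρ = Sat? φ ρ ×-dec Sat? ψ ρ
    Sat? (φ ∨' ψ) ρ = Sat? φ ρ ⊎-dec Sat? ψ ρ
    Sat? (∀' φ) ρ =
      Dec.map′ everywhere (λ s → ListAll.tabulate λ {c} _ → s c)
        (ListAll.all? (λ c → Sat? φ (c ∷ ρ)) reps)
      where
      reps = proj₁ (orbits ρ)
      everywhere : ListAll.All (λ c → Sat L M φ (c ∷ ρ)) reps → ∀ x → Sat L M φ (x ∷ ρ)
      everywhere onReps x with proj₂ (orbits ρ) x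
      ... | σ , fixes , σx∈reps =
        from (Sat-apply-fixing σ φ x fixes) (ListAll.lookup onReps σx∈reps)
    Sat? (∃' φ) ρ =
      Dec.map′ Any.satisfied somewhere (any? (λ c → Sat? φ (c ∷ ρ)) reps)
      where
      reps = proj₁ (orbits ρ)
      somewhere : Σ C (λ x → Sat L M φ (x ∷ ρ)) → Any.Any (λ c → Sat L M φ (c ∷ ρ)) reps
      somewhere (x , s) with proj₂ (orbits ρ) x
      ... | σ , fixes , σx∈reps = lose σx∈reps (to (Sat-apply-fixing σ φ x fixes) s)

Th : {L : Language} → Structure L → Theory L
Th {L} M φ = _⊨_ L M φ

Th-model : {L : Language} (M : Structure L) → IsModel L M (Th M)
Th-model M φ M⊨φ = M⊨φ

Th-complete : {L : Language} (M : Structure L) → (∀ φ → Dec (_⊨_ L M φ)) → Complete L (Th M)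
Th-complete {L} M ⊨? = (M , Th-model M) , λ φ → decided φ (⊨? φ)
  where
  decided : ∀ φ → Dec (_⊨_ L M φ) → _⊨ᵀ_ L (Th M) φ ⊎ _⊨ᵀ_ L (Th M) (¬' L φ)
  decided φ (yes M⊨φ) = inj₁ λ N N⊨Th → N⊨Th φ M⊨φ
  decided φ (no M⊭φ)  = inj₂ λ N N⊨Th → N⊨Th (¬' L φ) M⊭φ

module _ {L : Language} (M : Structure L) {A : Carrier M → Set} where

  private
    C = Carrier M

  dcl⊆acl : ∀ {b} → dcl L M A b → acl L M A b
  dcl⊆acl (k , φ , ā , ā∈A , (c , _ , unique) , sb) =
    k , φ , ā , ā∈A , (List.[ c ] , λ x s → Any.here (unique x s)) , sb

  acl-enumerated : (xs : List C) → (∀ x → x ∈ xs) → ∀ b → acl L M A b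
  acl-enumerated xs enumerates b =
    0 , (var zero ≐ var zero) , [] , [] , (xs , λ x _ → enumerates x) , refl

  moved∉dcl : (σ : Automorphism M) → let open Automorphism σ in
    (∀ a → A a → apply a ≡ a) → ∀ {b} → apply b ≢ b → ¬ dcl L M A b
  moved∉dcl σ fixesA σb≢b (k , φ , ā , ā∈A , (c , _ , unique) , sb) =
    σb≢b (trans (unique _ σb-solves) (sym (unique _ sb)))
    where
    open Automorphism σ
    σb-solves : Sat L M φ (apply _ ∷ ā)
    σb-solves = to (Sat-apply-fixing σ φ _ (map-fixed apply fixesA ā∈A)) sb

  acl⊈dcl⇒¬AclDclAbove : ∀ {m b} → CardGeq L M A m → acl L M A b → ¬ dcl L M A b →
                         ¬ AclDclAbove L (Th M) m
  acl⊈dcl⇒¬AclDclAbove |A|≥m b∈acl b∉dcl acl≡dcl =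
    b∉dcl (proj₁ (acl≡dcl M (Th-model M) A |A|≥m _) b∈acl)

-- λ = n : a pure set with n + 1 elements

emptyLanguage : Language
emptyLanguage = record { Func = λ _ → ⊥ ; Rel = λ _ → ⊥ }

pureSet : ℕ → Structure emptyLanguage
pureSet N = record { Carrier = Fin N ; funcᴹ = λ () ; relᴹ = λ () }

pureSet-complete : ∀ N → Complete emptyLanguage (Th (pureSet N))
pureSet-complete N = Th-complete (pureSet N) (λ φ → Sat? (pureSet N) Fin._≟_ (λ ()) orbits φ [])
  where
  orbits : ∀ {n} (ρ : Vec (Fin N) n) → Σ (List (Fin N)) (OrbitRepresentatives (pureSet N) ρ)
  orbits ρ = allFin N , λ x → identityAutomorphism , map-id ρ , ∈-allFin x

atMost : ℕ → Sentence emptyLanguage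
atMost N = ∀ⁿ {m = suc N} (¬' emptyLanguage pairwiseDistinct)

pureSet⊨atMost : ∀ N → _⊨_ emptyLanguage (pureSet N) (atMost N)
pureSet⊨atMost N = from (Sat-∀ⁿ (pureSet N) _) λ ρ s →
  noCollision ρ (to (Sat-pairwiseDistinct (pureSet N) ρ) s)
  where
  noCollision : (ρ : Vec (Fin N) (suc N)) → ¬ PairwiseDistinct ρ
  noCollision ρ distinct with Fin.pigeonhole (ℕ.n<1+n N) (lookup ρ)
  ... | i , j , i<j , ρi≡ρj = distinct i j (Fin.<⇒≢ i<j) ρi≡ρj

module ModelOfPureSet (n : ℕ) (M : Structure emptyLanguage)
                      (M⊨Th : IsModel emptyLanguage M (Th (pureSet (suc n)))) where

  private
    C = Carrier M

  -- Equality in an arbitrary model is decidable only because Th (pureSet (suc n)) says so.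
  _≟_ : DecidableEquality C
  _≟_ = to (Sat-equalityDecidable M)
          (M⊨Th equalityDecidable (from (Sat-equalityDecidable (pureSet (suc n))) Fin._≟_))

  ¬PairwiseDistinct : (ρ : Vec C (suc (suc n))) → ¬ PairwiseDistinct ρ
  ¬PairwiseDistinct ρ distinct =
    to (Sat-∀ⁿ M (¬' emptyLanguage pairwiseDistinct))
       (M⊨Th (atMost (suc n)) (pureSet⊨atMost (suc n))) ρ
       (from (Sat-pairwiseDistinct M ρ) distinct)

  Avoids : C → Vec C n → Set
  Avoids x ā = ∀ i → x ≢ lookup ā i

  avoiding-unique : ∀ {ā} → PairwiseDistinct ā → ∀ {y z} → Avoids y ā → Avoids z ā → y ≡ z
  avoiding-unique {ā} distinct {y} {z} y-avoids z-avoids with z ≟ y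
  ... | yes z≡y = sym z≡y
  ... | no z≢y  = ⊥-elim (¬PairwiseDistinct (z ∷ y ∷ ā)
                    (∷-pairwiseDistinct z-avoids′ (∷-pairwiseDistinct y-avoids distinct)))
    where
    z-avoids′ : ∀ i → z ≢ lookup (y ∷ ā) i
    z-avoids′ zero    = z≢y
    z-avoids′ (suc i) = z-avoids i

  avoiding : Formula emptyLanguage (suc n)
  avoiding = ⋀ λ i → ¬' emptyLanguage (var zero ≐ var (suc i))

  dcl-full : ∀ {A ā} → VecAll.All A ā → PairwiseDistinct ā → ∀ b → dcl emptyLanguage M A b
  dcl-full {ā = ā} ā∈A distinct b with Fin.any? (λ i → b ≟ lookup ā i)
  ... | yes (i , b≡āᵢ) =
    1 , (var zero ≐ var (suc zero)) , lookup ā i ∷ [] , lookup⁺ ā∈A i ∷ [] ,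
    (lookup ā i , refl , λ _ s → s) , b≡āᵢ
  ... | no b∉ā =
    n , avoiding , ā , ā∈A ,
    (b , from (Sat-⋀ M _ _) b-avoids ,
         λ c s → avoiding-unique {ā} distinct (to (Sat-⋀ M _ _) s) b-avoids) ,
    from (Sat-⋀ M _ _) b-avoids
    where
    b-avoids : Avoids b ā
    b-avoids i b≡āᵢ = b∉ā (i , b≡āᵢ)

pureSet-AclDclAbove : ∀ n → AclDclAbove emptyLanguage (Th (pureSet (suc n))) n
pureSet-AclDclAbove n M M⊨Th A (f , f-inj , f∈A) b =
  (λ _ → dcl-full (tabulate⁺ f∈A) (tabulate-pairwiseDistinct f-inj) b) , dcl⊆acl M
  where open ModelOfPureSet n M M⊨Th

pureSet-¬AclDclAbove : ∀ {m n} → m < n → ¬ AclDclAbove emptyLanguage (Th (pureSet (suc n))) m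
pureSet-¬AclDclAbove {m} {suc k} (s≤s m≤k) =
  acl⊈dcl⇒¬AclDclAbove M {A} card (acl-enumerated M (allFin _) ∈-allFin 0F)
    (moved∉dcl M swap01 fixesA moves0)
  where
  M = pureSet (suc (suc k))
  open Transposition (Fin._≟_ {suc (suc k)})
  swap01 : Automorphism M
  swap01 = involutiveAutomorphism (transpose 0F 1F) (transpose-involutive 0F 1F)
             (λ ()) (λ ())
  A : Fin (suc (suc k)) → Set
  A x = ∃ λ j → x ≡ suc (suc j)
  card : CardGeq emptyLanguage M A m
  card = (λ i → suc (suc (inject≤ i m≤k))) ,
         (λ eq → Fin.inject≤-injective m≤k m≤k _ _ (Fin.suc-injective (Fin.suc-injective eq))) ,
         (λ i → _ , refl)
  fixesA : ∀ a → A a → transpose 0F 1F a ≡ a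
  fixesA _ (j , refl) = transpose-fixed {0F} {1F} (λ ()) (λ ())
  moves0 : transpose 0F 1F 0F ≢ 0F
  moves0 eq = Fin.0≢1+n (trans (sym eq) (transpose-left 0F 1F))

-- λ = ∞ : an equivalence relation with infinitely many classes of size 3

eqRelLanguage : Language
eqRelLanguage = record { Func = λ _ → ⊥ ; Rel = λ k → k ≡ 2 }

Element : Set
Element = ℕ × Fin 3

sameClass : ∀ {k} → k ≡ 2 → Vec Element k → Set
sameClass refl (x ∷ y ∷ []) = proj₁ x ≡ proj₁ y

threeElementClasses : Structure eqRelLanguage
threeElementClasses = record { Carrier = Element ; funcᴹ = λ () ; relᴹ = sameClass }

classAutomorphism : (g : ℕ → ℕ) → Involutive _≡_ g → (h : Fin 3 → Fin 3) → Involutive _≡_ h →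
                    Automorphism threeElementClasses
classAutomorphism g gg≡id h hh≡id =
  involutiveAutomorphism (λ x → g (proj₁ x) , h (proj₂ x))
    (λ x → cong₂ _,_ (gg≡id (proj₁ x)) (hh≡id (proj₂ x))) (λ ()) preservesClasses
  where
  preservesClasses : ∀ {k} (R : k ≡ 2) xs → sameClass R xs →
                     sameClass R (map (λ x → g (proj₁ x) , h (proj₂ x)) xs)
  preservesClasses refl (x ∷ y ∷ []) = cong g

fresh : ∀ {n} → Vec Element n → ℕ
fresh []      = 0
fresh (x ∷ ρ) = suc (proj₁ x + fresh ρ)

fresh-bounds : ∀ {n} (ρ : Vec Element n) → VecAll.All (λ x → proj₁ x < fresh ρ) ρ
fresh-bounds [] = []
fresh-bounds (x ∷ ρ) = s≤s (ℕ.m≤m+n (proj₁ x) (fresh ρ)) ∷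
  VecAll.map (λ p → ℕ.<-≤-trans p (ℕ.m≤n⇒m≤1+n (ℕ.m≤n+m (fresh ρ) (proj₁ x))))
             (fresh-bounds ρ)

-- An element of a class above fresh ρ is moved into the class fresh ρ by transposing the
-- two classes, which fixes ρ; so the classes up to fresh ρ contain representatives of all orbits.
threeElementClasses-orbits : ∀ {n} (ρ : Vec Element n) →
  Σ (List Element) (OrbitRepresentatives threeElementClasses ρ)
threeElementClasses-orbits ρ = reps , representative
  where
  open Transposition ℕ._≟_
  m = fresh ρ
  reps = cartesianProduct (upTo (suc m)) (allFin 3)
  representative : OrbitRepresentatives threeElementClasses ρ reps
  representative (a , j) with a ℕ.≤? m
  ... | yes a≤m = identityAutomorphism ,
                  map-id ρ , ∈-cartesianProduct⁺ (∈-upTo⁺ (s≤s a≤m)) (∈-allFin j)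
  ... | no a≰m = classAutomorphism (transpose a m) (transpose-involutive a m) (λ y → y) (λ _ → refl) ,
                 map-fixed _ fixed (fresh-bounds ρ) ,
                 subst (λ c → (c , j) ∈ reps) (sym (transpose-left a m))
                   (∈-cartesianProduct⁺ (∈-upTo⁺ (ℕ.n<1+n m)) (∈-allFin j))
    where
    fixed : ∀ x → proj₁ x < m → (transpose a m (proj₁ x) , proj₂ x) ≡ x
    fixed x x<m = cong (_, proj₂ x) (transpose-fixed
      (λ x≡a → a≰m (ℕ.<⇒≤ (subst (_< m) x≡a x<m))) (λ x≡m → ℕ.<-irrefl x≡m x<m))

threeElementClasses-complete : Complete eqRelLanguage (Th threeElementClasses)
threeElementClasses-complete = Th-complete threeElementClasses
  (λ φ → Sat? threeElementClasses (≡-dec ℕ._≟_ Fin._≟_) sameClass?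
             threeElementClasses-orbits φ [])
  where
  sameClass? : ∀ {k} (R : k ≡ 2) xs → Dec (sameClass R xs)
  sameClass? refl (x ∷ y ∷ []) = proj₁ x ℕ.≟ proj₁ y

classOf : ℕ → List Element
classOf a = List.map (a ,_) (allFin 3)

∈-classOf : ∀ {a} x → proj₁ x ≡ a → x ∈ classOf a
∈-classOf (a , j) refl = ∈-map⁺ (a ,_) (∈-allFin j)

threeElementClasses-¬AclDclAbove : ∀ n → ¬ AclDclAbove eqRelLanguage (Th threeElementClasses) n
threeElementClasses-¬AclDclAbove n =
  acl⊈dcl⇒¬AclDclAbove threeElementClasses {A} card b∈acl
    (moved∉dcl threeElementClasses swap12 fixesA moves)
  where
  open Transposition (Fin._≟_ {3})
  A : Element → Set
  A x = proj₂ x ≡ 0F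
  card : CardGeq eqRelLanguage threeElementClasses A n
  card = (λ i → toℕ i , zero) , (λ eq → Fin.toℕ-injective (cong proj₁ eq)) , (λ _ → refl)
  b : Element
  b = 0 , 1F
  b∈acl : acl eqRelLanguage threeElementClasses A b
  b∈acl = 1 , rel refl (var zero ∷ var (suc zero) ∷ []) , (0 , zero) ∷ [] , refl ∷ [] ,
          (classOf 0 , ∈-classOf) , refl
  swap12 : Automorphism threeElementClasses
  swap12 = classAutomorphism (λ a → a) (λ _ → refl) (transpose 1F 2F) (transpose-involutive 1F 2F)
  fixesA : ∀ x → A x → (proj₁ x , transpose 1F 2F (proj₂ x)) ≡ x
  fixesA (a , zero) refl = cong (a ,_) (transpose-fixed {1F} {2F} (λ ()) (λ ()))
  moves : (0 , transpose 1F 2F 1F) ≢ b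
  moves eq = Fin.0≢1+n (Fin.suc-injective (trans (sym (cong proj₂ eq)) (transpose-left 1F 2F)))

theorem3p21 : (λ' : ℕ∞) → Σ Language λ L → Σ (Theory L) λ T →
    Complete L T × AclDclDif L T λ'
theorem3p21 (fin n) =
  emptyLanguage , Th (pureSet (suc n)) , pureSet-complete (suc n) ,
  pureSet-AclDclAbove n , λ m m<n → pureSet-¬AclDclAbove m<n
theorem3p21 ∞ =
  eqRelLanguage , Th threeElementClasses , threeElementClasses-complete ,
  threeElementClasses-¬AclDclAbove
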